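{- Let $N$ be a square-free positive integer that is a congruent number, i.e. $N$ is the area of a right triangle whose three sides are rational. Suppose the two perpendicular sides (legs) of such a triangle are $\alpha_1/\alpha_2$ and $\beta_1/\beta_2$, where $\alpha_1,\alpha_2,\beta_1,\beta_2$ are positive integers and both fractions are in reduced form, i.e. $\gcd(\alpha_1,\alpha_2)=\gcd(\beta_1,\beta_2)=1$. Then $\gcd(\alpha_1,\beta_1)=1$, $\gcd(\alpha_2,\beta_2)=1$, and $\alpha_1$ and $\beta_1$ have opposite parities.
   Context: A right triangle with legs $\alpha,\beta$ has area $\alpha\beta/2$, so the hypothesis means $\frac{\alpha_1}{\alpha_2}\cdot\frac{\beta_1}{\beta_2}=2N$ and $(\alpha_1/\alpha_2)^2+(\beta_1/\beta_2)^2$ is the square of a rational number (the hypotenuse). -}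

module Defs where

open import Data.Nat using (ℕ; _*_; _^_)
open import Data.Nat.Divisibility using (_∣_)
open import Relation.Binary.PropositionalEquality using (_≡_)

SquareFree : ℕ → Set
SquareFree N = ∀ (d : ℕ) → d ^ 2 ∣ N → d ≡ 1

-- A common factor of α₂ and β₂ is prime to α₁, hence divides β₁ = 2Nα₂β₂/α₁, contradicting
-- gcd(β₁, β₂) = 1.  The square of g = gcd(α₁, β₁) divides α₁β₁ = 2N·α₂β₂ and is prime to
-- α₂β₂, so g² ∣ 2N; once g is known to be odd, g² ∣ N and g = 1 as N is square-free.
-- The legs are not both odd since α₁β₁ is even.  If α₁ = 2a and β₁ = 2b, then α₂, β₂ are
-- odd, and ab = (N/2)·α₂β₂ with N/2 odd (4 ∤ N), so a and b are odd too.  Then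
-- (aβ₂)² + (bα₂)² = 2u with u odd, and the hypotenuse equation reads 2u(2h₂)² = h₁²(α₂β₂)²,
-- which is impossible: halving both sides shows by infinite descent that 2·odd·n² is never
-- odd·h².

module Submission where

open import Defs
open import Data.Nat using (ℕ; _*_; _+_; _^_; _%_; NonZero)
open import Data.Nat.GCD using (gcd)
open import Data.Product using (_×_; ∃₂)
open import Relation.Binary.PropositionalEquality using (_≡_; _≢_)

open import Data.Nat using (suc; _/_; _<_; s≤s; z≤n)
open import Data.Nat.Properties using (1+n≢n; *-assoc; *-comm; *-identityʳ; *-cancelˡ-≡; m<m*n; m*n≢0; m*n≢0⇒m≢0)
open import Data.Nat.DivMod using (m≡m%n+[m/n]*n; m%n<n; [m+kn]%n≡m%n)
open import Data.Nat.Divisibility using (_∣_; _∤_; divides; m%n≡0⇒n∣m; n∣m⇒m%n≡0; m∣m*n; ∣m⇒∣m*n; ∣n⇒∣m*n; ∣-refl; ∣-trans; *-pres-∣)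
open import Data.Nat.GCD using (gcd[m,n]∣m; gcd[m,n]∣n)
open import Data.Nat.Coprimality using (Coprime; coprime-divisor; 1-coprimeTo; gcd≡1⇒coprime; coprime⇒gcd≡1) renaming (sym to coprime-sym)
open import Data.Nat.Primality using (prime[2]; prime⇒irreducible)
open import Data.Nat.Induction using (<-rec)
open import Data.Nat.Solver using (module +-*-Solver)
open import Data.Product using (∃; _,_)
open import Data.Sum using (_⊎_; inj₁; inj₂)
open import Data.Empty using (⊥; ⊥-elim)
open import Relation.Nullary using (¬_)
open import Relation.Binary.PropositionalEquality using (refl; sym; trans; cong; subst; module ≡-Reasoning)

open +-*-Solver using (solve; _:=_; _:+_; _:*_; _:^_; con)
open ≡-Reasoning

Odd : ℕ → Set
Odd n = ∃ λ k → n ≡ 1 + k * 2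

even⊎odd : ∀ n → 2 ∣ n ⊎ Odd n
even⊎odd n with n % 2 | m%n<n n 2 | m≡m%n+[m/n]*n n 2
... | 0           | _            | n≡[n/2]*2   = inj₁ (divides (n / 2) n≡[n/2]*2)
... | 1           | _            | n≡1+[n/2]*2 = inj₂ (n / 2 , n≡1+[n/2]*2)
... | suc (suc _) | s≤s (s≤s ()) | _

odd⇒%2≡1 : ∀ {n} → Odd n → n % 2 ≡ 1
odd⇒%2≡1 (k , refl) = [m+kn]%n≡m%n 1 k 2

%2≡1⇒odd : ∀ {n} → n % 2 ≡ 1 → Odd n
%2≡1⇒odd {n} n%2≡1 = n / 2 , trans (m≡m%n+[m/n]*n n 2) (cong (_+ n / 2 * 2) n%2≡1)

odd⇒∤ : ∀ {n} → Odd n → 2 ∤ n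
odd⇒∤ {n} odd 2∣n with trans (sym (odd⇒%2≡1 odd)) (n∣m⇒m%n≡0 n 2 2∣n)
... | ()

∤⇒odd : ∀ {n} → 2 ∤ n → Odd n
∤⇒odd {n} 2∤n with even⊎odd n
... | inj₁ 2∣n = ⊥-elim (2∤n 2∣n)
... | inj₂ odd = odd

odd-* : ∀ {m n} → Odd m → Odd n → Odd (m * n)
odd-* (i , refl) (j , refl) = i + j + i * j * 2 , product i j
  where
  product : ∀ i j → (1 + i * 2) * (1 + j * 2) ≡ 1 + (i + j + i * j * 2) * 2
  product = solve 2 (λ i j → (con 1 :+ i :* con 2) :* (con 1 :+ j :* con 2)
                          := con 1 :+ (i :+ j :+ i :* j :* con 2) :* con 2) refl

odd-*⁻¹ : ∀ {m n} → Odd (m * n) → Odd m × Odd n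
odd-*⁻¹ {m} {n} odd = ∤⇒odd (λ 2∣m → odd⇒∤ odd (∣m⇒∣m*n n 2∣m))
                    , ∤⇒odd (λ 2∣n → odd⇒∤ odd (∣n⇒∣m*n m 2∣n))

odd-^2 : ∀ {n} → Odd n → Odd (n ^ 2)
odd-^2 odd = odd-* odd (odd-* odd (0 , refl))

odd^2+odd^2 : ∀ {m n} → Odd m → Odd n → ∃ λ u → Odd u × m ^ 2 + n ^ 2 ≡ 2 * u
odd^2+odd^2 (i , refl) (j , refl) = _ , (i * i + i + j * j + j , refl) , sum i j
  where
  sum : ∀ i j → (1 + i * 2) ^ 2 + (1 + j * 2) ^ 2 ≡ 2 * (1 + (i * i + i + j * j + j) * 2)
  sum = solve 2 (λ i j → (con 1 :+ i :* con 2) :^ 2 :+ (con 1 :+ j :* con 2) :^ 2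
                      := con 2 :* (con 1 :+ (i :* i :+ i :+ j :* j :+ j) :* con 2)) refl

opposite-parity : ∀ {m n} → (2 ∣ m → 2 ∣ n → ⊥) → (Odd m → Odd n → ⊥) → m % 2 ≢ n % 2
opposite-parity {m} {n} ¬even ¬odd m%2≡n%2 with even⊎odd m
... | inj₁ 2∣m = ¬even 2∣m (m%n≡0⇒n∣m n 2 (trans (sym m%2≡n%2) (n∣m⇒m%n≡0 m 2 2∣m)))
... | inj₂ odd = ¬odd odd (%2≡1⇒odd (trans (sym m%2≡n%2) (odd⇒%2≡1 odd)))

coprime-∣ˡ : ∀ {d m n} → d ∣ m → Coprime m n → Coprime d n
coprime-∣ˡ d∣m m⊥n (i∣d , i∣n) = m⊥n (∣-trans i∣d d∣m , i∣n)

coprime-*ˡ : ∀ {m n o} → Coprime m o → Coprime n o → Coprime (m * n) o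
coprime-*ˡ m⊥o n⊥o (i∣mn , i∣o) = n⊥o (coprime-divisor (coprime-∣ˡ i∣o (coprime-sym m⊥o)) i∣mn , i∣o)

coprime-*ʳ : ∀ {m n o} → Coprime m n → Coprime m o → Coprime m (n * o)
coprime-*ʳ m⊥n m⊥o = coprime-sym (coprime-*ˡ (coprime-sym m⊥n) (coprime-sym m⊥o))

coprime-^2 : ∀ {m n} → Coprime m n → Coprime (m ^ 2) n
coprime-^2 {n = n} m⊥n = coprime-*ˡ m⊥n (coprime-*ˡ m⊥n (1-coprimeTo n))

^2-∣-* : ∀ {d m n} → d ∣ m → d ∣ n → d ^ 2 ∣ m * n
^2-∣-* {d} {m} {n} d∣m d∣n = subst (_∣ m * n) (cong (d *_) (sym (*-identityʳ d))) (*-pres-∣ d∣m d∣n)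

odd⇒coprime[2] : ∀ {n} → Odd n → Coprime n 2
odd⇒coprime[2] odd (d∣n , d∣2) with prime⇒irreducible prime[2] d∣2
... | inj₁ d≡1 = d≡1
... | inj₂ refl = ⊥-elim (odd⇒∤ odd d∣n)

coprime-even⇒odd : ∀ {m n} → Coprime m n → 2 ∣ m → Odd n
coprime-even⇒odd m⊥n 2∣m = ∤⇒odd λ 2∣n → 1+n≢n (m⊥n (2∣m , 2∣n))

gcd-odd : ∀ {m n} → (2 ∣ m → 2 ∣ n → ⊥) → Odd (gcd m n)
gcd-odd {m} {n} ¬even = ∤⇒odd λ 2∣g → ¬even (∣-trans 2∣g (gcd[m,n]∣m m n)) (∣-trans 2∣g (gcd[m,n]∣n m n))

[m*2]^2*n : ∀ m n → (m * 2) ^ 2 * n ≡ 4 * (m ^ 2 * n)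
[m*2]^2*n = solve 2 (λ m n → (m :* con 2) :^ 2 :* n := con 4 :* (m :^ 2 :* n)) refl

2*odd*square≡square*odd⇒halves : ∀ {u w n h} → Odd u → Odd w → 2 * u * n ^ 2 ≡ h ^ 2 * w →
  ∃₂ λ m k → n ≡ m * 2 × h ≡ k * 2 × 2 * u * m ^ 2 ≡ k ^ 2 * w
2*odd*square≡square*odd⇒halves {u} {w} {n} {h} odd-u odd-w eq with even⊎odd h
... | inj₂ odd-h = ⊥-elim (odd⇒∤ (odd-* (odd-^2 odd-h) odd-w)
                                  (subst (2 ∣_) eq (∣m⇒∣m*n (n ^ 2) (m∣m*n u))))
... | inj₁ (divides k refl) with even⊎odd n
...   | inj₂ odd-n = ⊥-elim (odd⇒∤ (odd-* odd-u (odd-^2 odd-n))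
                                    (subst (2 ∣_) (sym un²≡2k²w) (m∣m*n (k ^ 2 * w))))
  where
  un²≡2k²w : u * n ^ 2 ≡ 2 * (k ^ 2 * w)
  un²≡2k²w = *-cancelˡ-≡ _ _ 2 (begin
    2 * (u * n ^ 2)    ≡⟨ sym (*-assoc 2 u (n ^ 2)) ⟩
    2 * u * n ^ 2      ≡⟨ eq ⟩
    (k * 2) ^ 2 * w    ≡⟨ [m*2]^2*n k w ⟩
    4 * (k ^ 2 * w)    ≡⟨ *-assoc 2 2 (k ^ 2 * w) ⟩
    2 * (2 * (k ^ 2 * w)) ∎)
...   | inj₁ (divides m refl) = m , k , refl , refl , *-cancelˡ-≡ _ _ 4 (begin
    4 * (2 * u * m ^ 2) ≡⟨ quadruple u m ⟩
    2 * u * (m * 2) ^ 2 ≡⟨ eq ⟩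
    (k * 2) ^ 2 * w     ≡⟨ [m*2]^2*n k w ⟩
    4 * (k ^ 2 * w)     ∎)
  where
  quadruple : ∀ u m → 4 * (2 * u * m ^ 2) ≡ 2 * u * (m * 2) ^ 2
  quadruple = solve 2 (λ u m → con 4 :* (con 2 :* u :* m :^ 2) := con 2 :* u :* (m :* con 2) :^ 2) refl

2*odd*square≢square*odd : ∀ {u w} → Odd u → Odd w →
  ∀ n → .{{NonZero n}} → ∀ h → 2 * u * n ^ 2 ≢ h ^ 2 * w
2*odd*square≢square*odd {u} {w} odd-u odd-w = <-rec Insoluble descend
  where
  Insoluble : ℕ → Set
  Insoluble n = .{{NonZero n}} → ∀ h → 2 * u * n ^ 2 ≢ h ^ 2 * w
  descend : ∀ n → (∀ {m} → m < n → Insoluble m) → Insoluble n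
  descend n smaller h eq with 2*odd*square≡square*odd⇒halves {n = n} {h = h} odd-u odd-w eq
  ... | m , k , refl , refl , eq′ =
    smaller (m<m*n m 2 {{m*n≢0⇒m≢0 m}} (s≤s (s≤s z≤n))) {{m*n≢0⇒m≢0 m}} k eq′

RationalHypotenuse : ℕ → ℕ → ℕ → ℕ → Set
RationalHypotenuse α₁ α₂ β₁ β₂ = ∃₂ λ h₁ h₂ → NonZero h₂ ×
  ((α₁ * β₂) ^ 2 + (β₁ * α₂) ^ 2) * h₂ ^ 2 ≡ h₁ ^ 2 * (α₂ * β₂) ^ 2

odd-halves⇒¬RationalHypotenuse : ∀ {a b α₂ β₂} → Odd a → Odd b → Odd α₂ → Odd β₂ →
  ¬ RationalHypotenuse (a * 2) α₂ (b * 2) β₂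
odd-halves⇒¬RationalHypotenuse {a} {b} {α₂} {β₂} odd-a odd-b odd-α₂ odd-β₂ (h₁ , h₂ , h₂≢0 , hyp)
  with odd^2+odd^2 (odd-* odd-a odd-β₂) (odd-* odd-b odd-α₂)
... | u , odd-u , sum≡2u =
  2*odd*square≢square*odd odd-u (odd-^2 (odd-* odd-α₂ odd-β₂))
                          (2 * h₂) {{m*n≢0 2 h₂ {{_}} {{h₂≢0}}}} h₁ (begin
    2 * u * (2 * h₂) ^ 2                                 ≡⟨ cong (_* (2 * h₂) ^ 2) (sym sum≡2u) ⟩
    ((a * β₂) ^ 2 + (b * α₂) ^ 2) * (2 * h₂) ^ 2         ≡⟨ doubled a b α₂ β₂ h₂ ⟩
    ((a * 2 * β₂) ^ 2 + (b * 2 * α₂) ^ 2) * h₂ ^ 2       ≡⟨ hyp ⟩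
    h₁ ^ 2 * (α₂ * β₂) ^ 2                               ∎)
  where
  doubled : ∀ a b p q h →
    ((a * q) ^ 2 + (b * p) ^ 2) * (2 * h) ^ 2 ≡ ((a * 2 * q) ^ 2 + (b * 2 * p) ^ 2) * h ^ 2
  doubled = solve 5 (λ a b p q h → ((a :* q) :^ 2 :+ (b :* p) :^ 2) :* (con 2 :* h) :^ 2
                                := ((a :* con 2 :* q) :^ 2 :+ (b :* con 2 :* p) :^ 2) :* h :^ 2) refl

squareFree-even⇒odd-half : ∀ {c} → SquareFree (c * 2) → Odd c
squareFree-even⇒odd-half sf = ∤⇒odd λ 2∣c → 1+n≢n (sf 2 (*-pres-∣ 2∣c (∣-refl {2})))

odd-halves-of-even-legs : ∀ {N a b w} → SquareFree N → Odd w →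
  a * 2 * (b * 2) ≡ 2 * N * w → Odd a × Odd b
odd-halves-of-even-legs {N} {a} {b} {w} sf odd-w area = halves-odd (even⊎odd N)
  where
  2ab≡Nw : 2 * (a * b) ≡ N * w
  2ab≡Nw = *-cancelˡ-≡ _ _ 2 (begin
    2 * (2 * (a * b)) ≡⟨ double-halves a b ⟩
    a * 2 * (b * 2)   ≡⟨ area ⟩
    2 * N * w         ≡⟨ *-assoc 2 N w ⟩
    2 * (N * w)       ∎)
    where
    double-halves : ∀ a b → 2 * (2 * (a * b)) ≡ a * 2 * (b * 2)
    double-halves = solve 2 (λ a b → con 2 :* (con 2 :* (a :* b)) := a :* con 2 :* (b :* con 2)) refl
  halves-odd : 2 ∣ N ⊎ Odd N → Odd a × Odd b
  halves-odd (inj₂ odd-N) = ⊥-elim (odd⇒∤ (odd-* odd-N odd-w) (subst (2 ∣_) 2ab≡Nw (m∣m*n (a * b))))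
  halves-odd (inj₁ (divides c N≡c*2)) =
    odd-*⁻¹ (subst Odd (sym ab≡cw) (odd-* odd-c odd-w))
    where
    odd-c : Odd c
    odd-c = squareFree-even⇒odd-half (subst SquareFree N≡c*2 sf)
    ab≡cw : a * b ≡ c * w
    ab≡cw = *-cancelˡ-≡ _ _ 2 (begin
      2 * (a * b) ≡⟨ 2ab≡Nw ⟩
      N * w       ≡⟨ cong (_* w) N≡c*2 ⟩
      c * 2 * w   ≡⟨ cong (_* w) (*-comm c 2) ⟩
      2 * c * w   ≡⟨ *-assoc 2 c w ⟩
      2 * (c * w) ∎)

legs-not-both-even : ∀ {N α₁ α₂ β₁ β₂} → SquareFree N → Coprime α₁ α₂ → Coprime β₁ β₂ →
  α₁ * β₁ ≡ 2 * N * (α₂ * β₂) → RationalHypotenuse α₁ α₂ β₁ β₂ → 2 ∣ α₁ → 2 ∣ β₁ → ⊥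
legs-not-both-even sf α₁⊥α₂ β₁⊥β₂ area hyp 2∣α₁@(divides a refl) 2∣β₁@(divides b refl)
  with coprime-even⇒odd α₁⊥α₂ 2∣α₁ | coprime-even⇒odd β₁⊥β₂ 2∣β₁
... | odd-α₂ | odd-β₂ with odd-halves-of-even-legs {a = a} {b} sf (odd-* odd-α₂ odd-β₂) area
...   | odd-a , odd-b = odd-halves⇒¬RationalHypotenuse odd-a odd-b odd-α₂ odd-β₂ hyp

coprime-denominators : ∀ {a₁ a₂ b₁ b₂} → Coprime a₁ a₂ → Coprime b₁ b₂ →
  a₂ ∣ a₁ * b₁ → Coprime a₂ b₂
coprime-denominators a₁⊥a₂ b₁⊥b₂ a₂∣a₁b₁ (d∣a₂ , d∣b₂) =
  b₁⊥b₂ (coprime-divisor (coprime-∣ˡ d∣a₂ (coprime-sym a₁⊥a₂)) (∣-trans d∣a₂ a₂∣a₁b₁) , d∣b₂)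

gcd[numerators]^2∣ : ∀ {a₁ a₂ b₁ b₂ k} → Coprime a₁ a₂ → Coprime b₁ b₂ →
  a₁ * b₁ ≡ k * (a₂ * b₂) → gcd a₁ b₁ ^ 2 ∣ k
gcd[numerators]^2∣ {a₁} {a₂} {b₁} {b₂} {k} a₁⊥a₂ b₁⊥b₂ product =
  coprime-divisor g²⊥a₂b₂ (subst (g ^ 2 ∣_) (trans product (*-comm k (a₂ * b₂))) (^2-∣-* g∣a₁ g∣b₁))
  where
  g = gcd a₁ b₁
  g∣a₁ : g ∣ a₁
  g∣a₁ = gcd[m,n]∣m a₁ b₁
  g∣b₁ : g ∣ b₁
  g∣b₁ = gcd[m,n]∣n a₁ b₁
  g²⊥a₂b₂ : Coprime (g ^ 2) (a₂ * b₂)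
  g²⊥a₂b₂ = coprime-^2 (coprime-*ʳ (coprime-∣ˡ g∣a₁ a₁⊥a₂) (coprime-∣ˡ g∣b₁ b₁⊥b₂))

coprime-numerators : ∀ {N α₁ α₂ β₁ β₂} → SquareFree N → Coprime α₁ α₂ → Coprime β₁ β₂ →
  α₁ * β₁ ≡ 2 * N * (α₂ * β₂) → (2 ∣ α₁ → 2 ∣ β₁ → ⊥) → gcd α₁ β₁ ≡ 1
coprime-numerators {α₁ = α₁} {β₁ = β₁} sf α₁⊥α₂ β₁⊥β₂ area ¬even =
  sf (gcd α₁ β₁) (coprime-divisor (odd⇒coprime[2] (odd-^2 (gcd-odd ¬even)))
                                  (gcd[numerators]^2∣ α₁⊥α₂ β₁⊥β₂ area))

theorem1 : (N α₁ α₂ β₁ β₂ : ℕ) →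
    .{{_ : NonZero N}} →
    .{{_ : NonZero α₁}} → .{{_ : NonZero α₂}} →
    .{{_ : NonZero β₁}} → .{{_ : NonZero β₂}} →
    SquareFree N →
    gcd α₁ α₂ ≡ 1 → gcd β₁ β₂ ≡ 1 →
    α₁ * β₁ ≡ 2 * N * (α₂ * β₂) →
    ∃₂ (λ (h₁ h₂ : ℕ) → NonZero h₂ ×
      ((α₁ * β₂) ^ 2 + (β₁ * α₂) ^ 2) * h₂ ^ 2 ≡ h₁ ^ 2 * (α₂ * β₂) ^ 2) →
    gcd α₁ β₁ ≡ 1 × gcd α₂ β₂ ≡ 1 × α₁ % 2 ≢ β₁ % 2
theorem1 N α₁ α₂ β₁ β₂ sf gcd[α₁,α₂]≡1 gcd[β₁,β₂]≡1 area hyp =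
    coprime-numerators sf α₁⊥α₂ β₁⊥β₂ area ¬both-even
  , coprime⇒gcd≡1 (coprime-denominators α₁⊥α₂ β₁⊥β₂ α₂∣α₁β₁)
  , opposite-parity ¬both-even ¬both-odd
  where
  α₁⊥α₂ : Coprime α₁ α₂
  α₁⊥α₂ = gcd≡1⇒coprime gcd[α₁,α₂]≡1
  β₁⊥β₂ : Coprime β₁ β₂
  β₁⊥β₂ = gcd≡1⇒coprime gcd[β₁,β₂]≡1
  α₂∣α₁β₁ : α₂ ∣ α₁ * β₁
  α₂∣α₁β₁ = subst (α₂ ∣_) (sym area) (∣n⇒∣m*n (2 * N) (m∣m*n β₂))
  ¬both-even : 2 ∣ α₁ → 2 ∣ β₁ → ⊥
  ¬both-even = legs-not-both-even sf α₁⊥α₂ β₁⊥β₂ area hyp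
  ¬both-odd : Odd α₁ → Odd β₁ → ⊥
  ¬both-odd odd-α₁ odd-β₁ =
    odd⇒∤ (odd-* odd-α₁ odd-β₁) (subst (2 ∣_) (sym area) (∣m⇒∣m*n (α₂ * β₂) (m∣m*n N)))
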